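{- Let $n\ge 3$ be an integer. Then $d_g(C_n)=2$ if $n=3$ and $d_g(C_n)=1$ if $n\ge 4$; and $d_g'(C_n)=1$ if $n\ge 5$ is odd, while $d_g'(C_n)=2$ if $n=3$ or $n$ is even.
   Context: $C_n$ denotes the cycle on $n$ vertices. For a vertex $x$, $N[x]$ denotes its closed neighborhood. The domatic number game on a graph $G$ with palette $[k]=\{1,\dots,k\}$: two players, Alice and Bob, alternately choose a previously unchosen vertex of $G$ and assign it a color from $[k]$, until every vertex has been colored. Let $V_i$ be the set of vertices colored $i$. Alice wins if every $V_i$ ($i\in[k]$) is a dominating set of $G$, i.e. for every vertex $x$ and every color $c\in[k]$ some vertex of $N[x]$ has color $c$; otherwise Bob wins. In the $A$-game Alice moves first; in the $B$-game Bob moves first. The game domatic number $d_g(G)$ is the largest $k$ for which Alice has a winning strategy in the $A$-game with palette $[k]$, and the delayed game domatic number $d_g'(G)$ is the largest $k$ for which Alice has a winning strategy in the $B$-game with palette $[k]$. -}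

module Defs where

open import Data.Nat using (ℕ; zero; suc; _∸_; _<_)
open import Data.Nat.Divisibility using (_∣_)
open import Data.Fin using (Fin; toℕ; _≟_)
open import Data.Maybe using (Maybe; just; nothing; Is-just)
open import Data.Product using (Σ; _×_)
open import Data.Sum using (_⊎_)
open import Data.Bool using (if_then_else_)
open import Relation.Nullary using (¬_; does)
open import Relation.Binary.PropositionalEquality using (_≡_)

Succ : (n : ℕ) → Fin n → Fin n → Set
Succ n i j = (suc (toℕ i) ≡ toℕ j) ⊎ ((suc (toℕ i) ≡ n) × (toℕ j ≡ 0))

Adj : (n : ℕ) → Fin n → Fin n → Set
Adj n i j = Succ n i j ⊎ Succ n j i

InN : (n : ℕ) → Fin n → Fin n → Set
InN n x y = (y ≡ x) ⊎ Adj n x y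

Position : ℕ → ℕ → Set
Position n k = Fin n → Maybe (Fin k)

empty : ∀ {n k} → Position n k
empty _ = nothing

update : ∀ {n k} → Position n k → Fin n → Fin k → Position n k
update p v c w = if does (w ≟ v) then just c else p w

Full : ∀ {n k} → Position n k → Set
Full p = ∀ v → Is-just (p v)

AllDominating : ∀ {n k} → Position n k → Set
AllDominating {n} {k} p = ∀ (x : Fin n) (c : Fin k) → Σ (Fin n) λ y → InN n x y × (p y ≡ just c)

data Player : Set where
  alice bob : Player

-- AliceWins n k pl p : Alice has a winning strategy in the domatic number
-- game on C_n with palette [k], from position p, with player pl to move.
data AliceWins (n k : ℕ) : Player → Position n k → Set where
  finished : ∀ {pl p} → Full p → AllDominating p → AliceWins n k pl p
  aliceMove : ∀ {p} (v : Fin n) (c : Fin k) → p v ≡ nothing →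
              AliceWins n k bob (update p v c) → AliceWins n k alice p
  bobMove : ∀ {p} → Σ (Fin n) (λ v → p v ≡ nothing) →
            (∀ (v : Fin n) (c : Fin k) → p v ≡ nothing → AliceWins n k alice (update p v c)) →
            AliceWins n k bob p

GameDomaticIs : ℕ → ℕ → Set
GameDomaticIs n m = AliceWins n m alice empty × (∀ k → m < k → ¬ AliceWins n k alice empty)

DelayedGameDomaticIs : ℕ → ℕ → Set
DelayedGameDomaticIs n m = AliceWins n m bob empty × (∀ k → m < k → ¬ AliceWins n k bob empty)

Even : ℕ → Set
Even n = 2 ∣ n

{-# OPTIONS --safe #-}
-- A closed neighbourhood in a cycle has three vertices, so with three or more colours
-- it must be rainbow: Bob wins by putting one colour on two adjacent vertices.  With two
-- colours and n ≥ 4, Bob copies Alice's first colour onto a neighbour and then threatens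
-- to make N[v] or N[next v] monochromatic; Alice cannot parry both threats.  In the
-- B-game on an even cycle Alice pairs 2i with 2i+1 and answers every move on the partner
-- with the other colour.  On an odd cycle Bob colours vertex 4 first and pairs the rest:
-- he answers on {0,3} with the opposite colour and on {1,2} with the same colour, which
-- leaves N[1] or N[2] monochromatic.  On C₃ every vertex dominates, so Alice only has to
-- make both colours appear.
module Submission where

open import Defs
open import Data.Nat using (ℕ; zero; suc; _+_; _*_; _≤_; _<_; z≤n; s≤s; _<?_)
open import Data.Nat.Properties
  using (≤-refl; ≤-antisym; ≮⇒≥; <⇒≤; <-irrefl; <-trans; +-monoʳ-<; m≤n⇒m<n∨m≡n)
open import Data.Nat.Induction using (<-wellFounded)
import Data.Nat.Properties as ℕ
open import Data.Nat.Divisibility using (divides)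
open import Data.Fin using (Fin; zero; suc; toℕ; fromℕ; fromℕ<; inject₁; _≟_)
open import Data.Fin.Properties using (toℕ-injective; toℕ<n; toℕ-fromℕ; toℕ-fromℕ<; toℕ-inject₁; any?)
import Data.Fin.Properties as Fin
open import Data.Maybe using (Maybe; just; nothing; maybe′; Is-just)
open import Data.Maybe.Properties using (just-injective)
import Data.Maybe.Properties as Maybe
import Data.Maybe.Relation.Unary.Any as Any
open import Data.Product using (∃; ∃₂; _×_; _,_; proj₁; proj₂)
open import Data.Sum using (_⊎_; inj₁; inj₂)
import Data.Sum as Sum
open import Data.Unit using (⊤; tt)
open import Function using (_∘_; id)
open import Induction.WellFounded using (Acc; acc)
open import Relation.Nullary using (¬_; Dec; yes; no; contradiction)
open import Relation.Nullary.Decidable using (dec-true; dec-false)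
open import Relation.Binary.PropositionalEquality using (_≡_; _≢_; refl; sym; trans; cong; subst)

pattern one = suc zero
pattern two = suc (suc zero)
pattern three = suc (suc (suc zero))
pattern four = suc (suc (suc (suc zero)))
pattern five+ j = suc (suc (suc (suc (suc j))))

update-≡ : ∀ {n k} (p : Position n k) v c → update p v c v ≡ just c
update-≡ p v c rewrite dec-true (v ≟ v) refl = refl

update-≢ : ∀ {n k} (p : Position n k) {u} v c → u ≢ v → update p v c u ≡ p u
update-≢ p {u} v c u≢v rewrite dec-false (u ≟ v) u≢v = refl

update-keeps-free : ∀ {n k} (p : Position n k) {u} v c →
  u ≢ v → p u ≡ nothing → update p v c u ≡ nothing
update-keeps-free p v c u≢v pu = trans (update-≢ p v c u≢v) pu

coloured≢free : ∀ {n k} {p : Position n k} {u v d} → p u ≡ just d → p v ≡ nothing → u ≢ v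
coloured≢free pu pv refl with trans (sym pu) pv
... | ()

update-keeps-colour : ∀ {n k} (p : Position n k) {u d} v c →
  p v ≡ nothing → p u ≡ just d → update p v c u ≡ just d
update-keeps-colour p v c pv pu = trans (update-≢ p v c (coloured≢free pu pv)) pu

free⇒¬Full : ∀ {n k} {p : Position n k} {v} → p v ≡ nothing → ¬ Full p
free⇒¬Full {v = v} pv full with subst Is-just pv (full v)
... | ()

free-or-full : ∀ {n k} (p : Position n k) → (∃ λ v → p v ≡ nothing) ⊎ Full p
free-or-full p with any? (λ v → Maybe.≡-dec _≟_ (p v) nothing)
... | yes free = inj₁ free
... | no ¬free = inj₂ λ v → coloured (p v) (λ pv → ¬free (v , pv))
  where
  coloured : ∀ {A : Set} (x : Maybe A) → x ≢ nothing → Is-just x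
  coloured nothing x≢nothing = contradiction refl x≢nothing
  coloured (just _) _ = Any.just tt

#free : ∀ {n k} → Position n k → ℕ
#free {zero} p = 0
#free {suc n} p = maybe′ (λ _ → 0) 1 (p zero) + #free (p ∘ suc)

#free-update : ∀ {n k} (p : Position n k) v c → p v ≡ nothing → #free (update p v c) < #free p
#free-update {suc n} p zero c pv rewrite pv = ≤-refl
#free-update {suc n} p (suc v) c pv =
  +-monoʳ-< (maybe′ (λ _ → 0) 1 (p zero)) (#free-update (p ∘ suc) v c pv)

Persistent : ∀ {n k} → (Position n k → Set) → Set
Persistent {n} {k} P = ∀ {p : Position n k} {v c} → p v ≡ nothing → P p → P (update p v c)

module _ {n k : ℕ} where

  ¬win-by-bob-move : ∀ {p : Position n k} v c →
    p v ≡ nothing → ¬ AliceWins n k alice (update p v c) → ¬ AliceWins n k bob p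
  ¬win-by-bob-move v c pv lost (finished full _) = free⇒¬Full pv full
  ¬win-by-bob-move v c pv lost (bobMove _ reply) = lost (reply v c pv)

  ¬win-against-all-alice-moves : ∀ {p : Position n k} → (∃ λ v → p v ≡ nothing) →
    (∀ w d → p w ≡ nothing → ¬ AliceWins n k bob (update p w d)) → ¬ AliceWins n k alice p
  ¬win-against-all-alice-moves (_ , pv) lost (finished full _) = free⇒¬Full pv full
  ¬win-against-all-alice-moves _ lost (aliceMove w d pw win) = lost w d pw win

  loses-with-persistent-defect : Fin k → (D : Position n k → Set) → Persistent D →
    (∀ {p} → D p → ¬ AllDominating p) → ∀ {pl p} → D p → ¬ AliceWins n k pl p
  loses-with-persistent-defect c₀ D persists fatal d (finished _ dom) = fatal d dom
  loses-with-persistent-defect c₀ D persists fatal d (aliceMove _ _ pv win) =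
    loses-with-persistent-defect c₀ D persists fatal (persists pv d) win
  loses-with-persistent-defect c₀ D persists fatal d (bobMove (v , pv) reply) =
    loses-with-persistent-defect c₀ D persists fatal (persists pv d) (reply v c₀ pv)

  wins-with-persistent-invariant : Fin k → (I : Position n k → Set) → Persistent I →
    (∀ {p} → I p → Full p → AllDominating p) → ∀ pl {p} → I p → AliceWins n k pl p
  wins-with-persistent-invariant c₀ I persists good pl {p} i = go pl i (<-wellFounded (#free p))
    where
    go : ∀ pl {p} → I p → Acc _<_ (#free p) → AliceWins n k pl p
    go pl {p} i (acc rec) with free-or-full p | pl
    ... | inj₂ full | _ = finished full (good i full)
    ... | inj₁ (v , pv) | alice =
      aliceMove v c₀ pv (go bob (persists pv i) (rec (#free-update p v c₀ pv)))
    ... | inj₁ (v , pv) | bob =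
      bobMove (v , pv) λ w c pw → go alice (persists pw i) (rec (#free-update p w c pw))

Is-just⇒≡just-zero : ∀ {m : Maybe (Fin 1)} → Is-just m → m ≡ just zero
Is-just⇒≡just-zero (Any.just {x = zero} _) = refl

win-1colour : ∀ {n} pl → AliceWins n 1 pl empty
win-1colour {n} pl = wins-with-persistent-invariant zero (λ _ → ⊤) (λ _ _ → tt) full⇒dominating pl tt
  where
  full⇒dominating : ∀ {p : Position n 1} → ⊤ → Full p → AllDominating p
  full⇒dominating _ full x zero = x , inj₁ refl , Is-just⇒≡just-zero (full x)

-- Pairing strategies: a move v, c is answered by colouring the partner σ v with ρ v c,
-- which keeps the colours of every coloured pair related by R.

module Pairing {n k} (σ : Fin n → Fin n) (σ-involutive : ∀ v → σ (σ v) ≡ v)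
  (R : Fin n → Fin k → Fin k → Set) (ρ : Fin n → Fin k → Fin k)
  (R-ρ : ∀ v c → R v c (ρ v c)) (R-σ-ρ : ∀ v c → R (σ v) (ρ v c) c) where

  data PairStatus (p : Position n k) (u : Fin n) : Set where
    both-free : p u ≡ nothing → σ u ≢ u → p (σ u) ≡ nothing → PairStatus p u
    coloured : ∀ {a b} → p u ≡ just a → p (σ u) ≡ just b → R u a b → PairStatus p u

  Paired : Position n k → Set
  Paired p = ∀ u → PairStatus p u

  respond : Position n k → Fin n → Fin k → Position n k
  respond p v c = update (update p v c) (σ v) (ρ v c)

  σ-injective : ∀ {u v} → σ u ≡ σ v → u ≡ v
  σ-injective {u} {v} eq = trans (sym (σ-involutive u)) (trans (cong σ eq) (σ-involutive v))

  σ-transpose : ∀ {u v} → σ u ≡ v → u ≡ σ v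
  σ-transpose {u} eq = trans (sym (σ-involutive u)) (cong σ eq)

  PairStatus-transport : ∀ {p p' u} →
    p' u ≡ p u → p' (σ u) ≡ p (σ u) → PairStatus p u → PairStatus p' u
  PairStatus-transport eq eqσ (both-free pu σu≢u pσu) = both-free (trans eq pu) σu≢u (trans eqσ pσu)
  PairStatus-transport eq eqσ (coloured pu pσu r) = coloured (trans eq pu) (trans eqσ pσu) r

  reply-free : ∀ {p v} c → Paired p → p v ≡ nothing → update p v c (σ v) ≡ nothing
  reply-free {p} {v} c paired pv with paired v
  ... | both-free _ σv≢v pσv = update-keeps-free p v c σv≢v pσv
  ... | coloured pv' _ _ with trans (sym pv') pv
  ...   | ()

  respond-≡ : ∀ {p v} c → Paired p → p v ≡ nothing → respond p v c v ≡ just c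
  respond-≡ {p} {v} c paired pv =
    update-keeps-colour (update p v c) (σ v) (ρ v c) (reply-free c paired pv) (update-≡ p v c)

  respond-≢ : ∀ p {u} v c → u ≢ v → u ≢ σ v → respond p v c u ≡ p u
  respond-≢ p v c u≢v u≢σv = trans (update-≢ (update p v c) (σ v) (ρ v c) u≢σv) (update-≢ p v c u≢v)

  Paired-respond : ∀ {p v} c → Paired p → p v ≡ nothing → Paired (respond p v c)
  Paired-respond {p} {v} c paired pv u with u ≟ v | u ≟ σ v
  ... | yes refl | _ = coloured (respond-≡ c paired pv) (update-≡ (update p u c) (σ u) (ρ u c)) (R-ρ u c)
  ... | no _ | yes refl =
    coloured (update-≡ (update p v c) (σ v) (ρ v c))
             (subst (λ w → respond p v c w ≡ just c) (sym (σ-involutive v)) (respond-≡ c paired pv))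
             (R-σ-ρ v c)
  ... | no u≢v | no u≢σv =
    PairStatus-transport (respond-≢ p v c u≢v u≢σv)
                         (respond-≢ p v c (u≢σv ∘ σ-transpose) (u≢v ∘ σ-injective)) (paired u)

  alice-wins : (∀ {p} → Paired p → Full p → AllDominating p) →
    ∀ {p} → Paired p → AliceWins n k bob p
  alice-wins good {p} paired = go paired (<-wellFounded (#free p))
    where
    go : ∀ {p} → Paired p → Acc _<_ (#free p) → AliceWins n k bob p
    go {p} paired (acc rec) with free-or-full p
    ... | inj₂ full = finished full (good paired full)
    ... | inj₁ free = bobMove free λ v c pv →
      aliceMove (σ v) (ρ v c) (reply-free c paired pv)
        (go (Paired-respond c paired pv)
            (rec (<-trans (#free-update (update p v c) (σ v) (ρ v c) (reply-free c paired pv))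
                          (#free-update p v c pv))))

  bob-wins : (∀ {p} → Paired p → Full p → ¬ AllDominating p) →
    ∀ {p} → Paired p → ¬ AliceWins n k alice p
  bob-wins bad paired (finished full dom) = bad paired full dom
  bob-wins bad paired (aliceMove v c pv (finished full _)) = free⇒¬Full (reply-free c paired pv) full
  bob-wins bad paired (aliceMove v c pv (bobMove _ reply)) =
    bob-wins bad (Paired-respond c paired pv) (reply (σ v) (ρ v c) (reply-free c paired pv))

-- Succ n i j unfolds to SuccMod n (toℕ i) (toℕ j).
SuccMod : ℕ → ℕ → ℕ → Set
SuccMod n i j = (suc i ≡ j) ⊎ ((suc i ≡ n) × (j ≡ 0))

succMod-irrefl : ∀ {m i} → ¬ SuccMod (2 + m) i i
succMod-irrefl (inj₁ ())
succMod-irrefl (inj₂ (() , refl))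

succMod-asym : ∀ {m i j} → SuccMod (3 + m) i j → ¬ SuccMod (3 + m) j i
succMod-asym (inj₁ refl) (inj₁ ())
succMod-asym (inj₁ refl) (inj₂ (() , refl))
succMod-asym (inj₂ (() , refl)) (inj₁ refl)
succMod-asym (inj₂ (_ , refl)) (inj₂ (() , refl))

succMod-no-triangle : ∀ {m i j l} → SuccMod (4 + m) i j → SuccMod (4 + m) j l → ¬ SuccMod (4 + m) l i
succMod-no-triangle (inj₁ refl) (inj₁ refl) (inj₁ ())
succMod-no-triangle (inj₁ refl) (inj₁ refl) (inj₂ (() , refl))
succMod-no-triangle (inj₁ refl) (inj₂ (() , refl)) (inj₁ refl)
succMod-no-triangle (inj₁ refl) (inj₂ (_ , refl)) (inj₂ (() , refl))
succMod-no-triangle (inj₂ (() , refl)) (inj₁ refl) (inj₁ refl)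
succMod-no-triangle (inj₂ (_ , refl)) (inj₁ refl) (inj₂ (() , refl))
succMod-no-triangle (inj₂ (_ , refl)) (inj₂ (() , refl)) _

succMod-functional : ∀ {n i j j'} → j < n → j' < n → SuccMod n i j → SuccMod n i j' → j ≡ j'
succMod-functional _ _ (inj₁ refl) (inj₁ refl) = refl
succMod-functional j<n _ (inj₁ refl) (inj₂ (refl , _)) = contradiction j<n (<-irrefl refl)
succMod-functional _ j'<n (inj₂ (refl , _)) (inj₁ refl) = contradiction j'<n (<-irrefl refl)
succMod-functional _ _ (inj₂ (_ , refl)) (inj₂ (_ , refl)) = refl

succMod-injective : ∀ {n i i' j} → SuccMod n i j → SuccMod n i' j → i ≡ i'
succMod-injective (inj₁ refl) (inj₁ eq) = ℕ.suc-injective (sym eq)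
succMod-injective (inj₁ refl) (inj₂ (_ , ()))
succMod-injective (inj₂ (_ , refl)) (inj₁ ())
succMod-injective (inj₂ (eq , _)) (inj₂ (eq' , _)) = ℕ.suc-injective (trans eq (sym eq'))

Succ⇒≢ : ∀ {m} {i j : Fin (2 + m)} → Succ _ i j → i ≢ j
Succ⇒≢ s refl = succMod-irrefl s

Succ²⇒≢ : ∀ {m} {i j l : Fin (3 + m)} → Succ _ i j → Succ _ j l → i ≢ l
Succ²⇒≢ s t refl = succMod-asym s t

Succ³⇒≢ : ∀ {m} {i j l r : Fin (4 + m)} → Succ _ i j → Succ _ j l → Succ _ l r → i ≢ r
Succ³⇒≢ s t u refl = succMod-no-triangle s t u

Succ-functional : ∀ {n} {x a b : Fin n} → Succ n x a → Succ n x b → a ≡ b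
Succ-functional {a = a} {b} s t = toℕ-injective (succMod-functional (toℕ<n a) (toℕ<n b) s t)

Succ-injective : ∀ {n} {x a b : Fin n} → Succ n a x → Succ n b x → a ≡ b
Succ-injective s t = toℕ-injective (succMod-injective s t)

Adj-at-most-two : ∀ {n} {x y a b : Fin n} →
  Adj n x y → Adj n x a → Adj n x b → y ≡ a ⊎ y ≡ b ⊎ a ≡ b
Adj-at-most-two (inj₁ s) (inj₁ t) _ = inj₁ (Succ-functional s t)
Adj-at-most-two (inj₁ s) (inj₂ _) (inj₁ t) = inj₂ (inj₁ (Succ-functional s t))
Adj-at-most-two (inj₁ _) (inj₂ s) (inj₂ t) = inj₂ (inj₂ (Succ-injective s t))
Adj-at-most-two (inj₂ s) (inj₂ t) _ = inj₁ (Succ-injective s t)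
Adj-at-most-two (inj₂ s) (inj₁ _) (inj₂ t) = inj₂ (inj₁ (Succ-injective s t))
Adj-at-most-two (inj₂ _) (inj₁ s) (inj₁ t) = inj₂ (inj₂ (Succ-functional s t))

successor : ∀ {n} (x : Fin n) → ∃ (Succ n x)
successor {suc n} x with suc (toℕ x) <? suc n
... | yes x+1<n = fromℕ< x+1<n , inj₁ (sym (toℕ-fromℕ< x+1<n))
... | no x+1≮n = zero , inj₂ (≤-antisym (toℕ<n x) (≮⇒≥ x+1≮n) , refl)

predecessor : ∀ {n} (x : Fin n) → ∃ λ w → Succ n w x
predecessor {suc n} zero = fromℕ n , inj₂ (cong suc (toℕ-fromℕ n) , refl)
predecessor {suc n} (suc x) = inject₁ x , inj₁ (cong suc (toℕ-inject₁ x))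

InN-≢colour⇒Adj : ∀ {n k} {p : Position n k} {x w c d} →
  InN n x w → p x ≡ just c → p w ≡ just d → d ≢ c → Adj n x w
InN-≢colour⇒Adj (inj₁ refl) px pw d≢c = contradiction (just-injective (trans (sym pw) px)) d≢c
InN-≢colour⇒Adj (inj₂ x~w) _ _ _ = x~w

-- Three or more colours

Clash : ∀ {n k} → Position n k → Set
Clash {n} p = ∃₂ λ x y → Adj n x y × ∃ λ c → p x ≡ just c × p y ≡ just c

Clash-persistent : ∀ {n k} → Persistent (Clash {n} {k})
Clash-persistent {p = p} {v} {c} pv (x , y , x~y , d , px , py) =
  x , y , x~y , d , update-keeps-colour p v c pv px , update-keeps-colour p v c pv py

two-other-colours : ∀ {k} (c : Fin (3 + k)) → ∃₂ λ i j → i ≢ c × j ≢ c × i ≢ j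
two-other-colours zero = one , two , (λ ()) , (λ ()) , (λ ())
two-other-colours one = zero , two , (λ ()) , (λ ()) , (λ ())
two-other-colours (suc (suc c)) = zero , one , (λ ()) , (λ ()) , (λ ())

Clash⇒¬dominating : ∀ {n k} {p : Position n (3 + k)} → Clash p → ¬ AllDominating p
Clash⇒¬dominating (x , y , x~y , c , px , py) dom with two-other-colours c
... | i , j , i≢c , j≢c , i≢j with dom x i | dom x j
... | wi , x∋wi , pwi | wj , x∋wj , pwj
  with Adj-at-most-two x~y (InN-≢colour⇒Adj x∋wi px pwi i≢c) (InN-≢colour⇒Adj x∋wj px pwj j≢c)
... | inj₁ refl = i≢c (just-injective (trans (sym pwi) py))
... | inj₂ (inj₁ refl) = j≢c (just-injective (trans (sym pwj) py))
... | inj₂ (inj₂ refl) = i≢j (just-injective (trans (sym pwi) pwj))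

clash-threat : ∀ {n k} {p : Position n (3 + k)} {x y c} →
  Adj n x y → p x ≡ just c → p y ≡ nothing → ¬ AliceWins n (3 + k) bob p
clash-threat {p = p} {x} {y} {c} x~y px py = ¬win-by-bob-move y c py
  (loses-with-persistent-defect zero Clash Clash-persistent Clash⇒¬dominating
    (x , y , x~y , c , update-keeps-colour p y c py px , update-≡ p y c))

¬win-A-3colours : ∀ {n k} → 3 ≤ n → 2 < k → ¬ AliceWins n k alice empty
¬win-A-3colours {n} {k} (s≤s (s≤s (s≤s _))) (s≤s (s≤s (s≤s _))) =
  ¬win-against-all-alice-moves (zero , refl) copy
  where
  copy : ∀ v (c : Fin k) → empty v ≡ nothing → ¬ AliceWins n k bob (update empty v c)
  copy v c _ with successor v
  ... | w , v→w =
    clash-threat (inj₁ v→w) (update-≡ empty v c) (update-keeps-free empty v c (Succ⇒≢ v→w ∘ sym) refl)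

¬win-B-3colours : ∀ {n k} → 3 ≤ n → 2 < k → ¬ AliceWins n k bob empty
¬win-B-3colours {n} {k} (s≤s (s≤s (s≤s _))) (s≤s (s≤s (s≤s _))) =
  ¬win-by-bob-move zero zero refl (¬win-against-all-alice-moves (s , s-free) threat)
  where
  p₁ : Position n k
  p₁ = update empty zero zero

  s : Fin n
  s = proj₁ (successor zero)
  0→s : Succ n zero s
  0→s = proj₂ (successor zero)
  l : Fin n
  l = proj₁ (predecessor zero)
  l→0 : Succ n l zero
  l→0 = proj₂ (predecessor zero)

  s-free : p₁ s ≡ nothing
  s-free = update-keeps-free empty zero zero (Succ⇒≢ 0→s ∘ sym) refl
  l-free : p₁ l ≡ nothing
  l-free = update-keeps-free empty zero zero (Succ⇒≢ l→0) refl

  threat : ∀ w d → p₁ w ≡ nothing → ¬ AliceWins n k bob (update p₁ w d)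
  threat w d pw with w ≟ s
  ... | no w≢s = clash-threat (inj₁ 0→s) (update-keeps-colour p₁ {u = zero} w d pw refl)
                   (update-keeps-free p₁ w d (w≢s ∘ sym) s-free)
  ... | yes refl = clash-threat (inj₂ l→0) (update-keeps-colour p₁ {u = zero} w d pw refl)
                     (update-keeps-free p₁ s d (Succ²⇒≢ l→0 0→s) l-free)

-- Two colours

other : Fin 2 → Fin 2
other zero = one
other one = zero

other-≢ : ∀ c → other c ≢ c
other-≢ zero ()
other-≢ one ()

other-involutive : ∀ c → other (other c) ≡ c
other-involutive zero = refl
other-involutive one = refl

other-cases : ∀ a c → c ≡ a ⊎ c ≡ other a
other-cases zero zero = inj₁ refl
other-cases zero one = inj₂ refl
other-cases one zero = inj₂ refl
other-cases one one = inj₁ refl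

MonochromaticAt : ∀ {n k} → Position n k → Fin n → Fin k → Set
MonochromaticAt {n} p x c = ∀ w → InN n x w → p w ≡ just c

Monochromatic : ∀ {n k} → Position n k → Set
Monochromatic p = ∃₂ (MonochromaticAt p)

Monochromatic-persistent : ∀ {n k} → Persistent (Monochromatic {n} {k})
Monochromatic-persistent {p = p} {v} {c} pv (x , d , mono) =
  x , d , λ w x∋w → update-keeps-colour p v c pv (mono w x∋w)

Monochromatic⇒¬dominating : ∀ {n} {p : Position n 2} → Monochromatic p → ¬ AllDominating p
Monochromatic⇒¬dominating (x , c , mono) dom with dom x (other c)
... | w , x∋w , pw = other-≢ c (just-injective (trans (sym pw) (mono w x∋w)))

MonochromaticAt-from-neighbours : ∀ {n k} {p : Position n k} {x y z c} →
  Adj n x y → Adj n x z → y ≢ z →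
  p x ≡ just c → p y ≡ just c → p z ≡ just c → MonochromaticAt p x c
MonochromaticAt-from-neighbours x~y x~z y≢z px py pz w (inj₁ refl) = px
MonochromaticAt-from-neighbours x~y x~z y≢z px py pz w (inj₂ x~w) with Adj-at-most-two x~w x~y x~z
... | inj₁ refl = py
... | inj₂ (inj₁ refl) = pz
... | inj₂ (inj₂ y≡z) = contradiction y≡z y≢z

monochromatic-threat : ∀ {n} {p : Position n 2} {x y z c} → Adj n x y → Adj n x z → y ≢ z →
  p x ≡ just c → p y ≡ just c → p z ≡ nothing → ¬ AliceWins n 2 bob p
monochromatic-threat {p = p} {x} {y} {z} {c} x~y x~z y≢z px py pz = ¬win-by-bob-move z c pz
  (loses-with-persistent-defect zero Monochromatic Monochromatic-persistent Monochromatic⇒¬dominating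
    (x , c , MonochromaticAt-from-neighbours x~y x~z y≢z (keep px) (keep py) (update-≡ p z c)))
  where
  keep : ∀ {u} → p u ≡ just c → update p z c u ≡ just c
  keep = update-keeps-colour p z c pz

¬win-A-2colours : ∀ {n} → 4 ≤ n → ¬ AliceWins n 2 alice empty
¬win-A-2colours {n} (s≤s (s≤s (s≤s (s≤s _)))) = ¬win-against-all-alice-moves (zero , refl) opening
  where
  opening : ∀ v c → empty v ≡ nothing → ¬ AliceWins n 2 bob (update empty v c)
  opening v c _ with predecessor v | successor v
  ... | b , b→v | a , v→a with successor a
  ... | e , a→e = ¬win-by-bob-move a c a-free (¬win-against-all-alice-moves (b , b-free) second)
    where
    p₁ p₂ : Position n 2
    p₁ = update empty v c
    p₂ = update p₁ a c

    a-free : p₁ a ≡ nothing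
    a-free = update-keeps-free empty v c (Succ⇒≢ v→a ∘ sym) refl
    b-free : p₂ b ≡ nothing
    b-free = update-keeps-free p₁ a c (Succ²⇒≢ b→v v→a)
               (update-keeps-free empty v c (Succ⇒≢ b→v) refl)
    e-free : p₂ e ≡ nothing
    e-free = update-keeps-free p₁ a c (Succ⇒≢ a→e ∘ sym)
               (update-keeps-free empty v c (Succ²⇒≢ v→a a→e ∘ sym) refl)
    v-colour : p₂ v ≡ just c
    v-colour = update-keeps-colour p₁ {u = v} a c a-free (update-≡ empty v c)
    a-colour : p₂ a ≡ just c
    a-colour = update-≡ p₁ a c

    second : ∀ w d → p₂ w ≡ nothing → ¬ AliceWins n 2 bob (update p₂ w d)
    second w d pw = threat (w ≟ b)
      where
      keep : ∀ u → p₂ u ≡ just c → update p₂ w d u ≡ just c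
      keep u = update-keeps-colour p₂ {u = u} w d pw

      threat : Dec (w ≡ b) → ¬ AliceWins n 2 bob (update p₂ w d)
      threat (no w≢b) = monochromatic-threat (inj₁ v→a) (inj₂ b→v) (Succ²⇒≢ b→v v→a ∘ sym)
        (keep v v-colour) (keep a a-colour) (update-keeps-free p₂ w d (w≢b ∘ sym) b-free)
      threat (yes w≡b) = monochromatic-threat (inj₂ v→a) (inj₁ a→e) (Succ²⇒≢ v→a a→e)
        (keep a a-colour) (keep v v-colour)
        (update-keeps-free p₂ w d (λ e≡w → Succ³⇒≢ b→v v→a a→e (sym (trans e≡w w≡b))) e-free)

-- The triangle

InN-C₃ : ∀ x y → InN 3 x y
InN-C₃ zero zero = inj₁ refl
InN-C₃ zero one = inj₂ (inj₁ (inj₁ refl))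
InN-C₃ zero two = inj₂ (inj₂ (inj₂ (refl , refl)))
InN-C₃ one zero = inj₂ (inj₂ (inj₁ refl))
InN-C₃ one one = inj₁ refl
InN-C₃ one two = inj₂ (inj₁ (inj₁ refl))
InN-C₃ two zero = inj₂ (inj₁ (inj₂ (refl , refl)))
InN-C₃ two one = inj₂ (inj₂ (inj₁ refl))
InN-C₃ two two = inj₁ refl

EveryColourUsed : ∀ {n k} → Position n k → Set
EveryColourUsed {k = k} p = ∀ (c : Fin k) → ∃ λ v → p v ≡ just c

EveryColourUsed-persistent : ∀ {n k} → Persistent (EveryColourUsed {n} {k})
EveryColourUsed-persistent {p = p} {v} {c} pv used d with used d
... | u , pu = u , update-keeps-colour p v c pv pu

EveryColourUsed⇒dominating-C₃ : ∀ {k} {p : Position 3 k} → EveryColourUsed p → AllDominating p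
EveryColourUsed⇒dominating-C₃ used x c with used c
... | v , pv = v , InN-C₃ x v , pv

both-colours-used : ∀ {n} {p : Position n 2} {u v c} →
  p u ≡ just c → p v ≡ just (other c) → EveryColourUsed p
both-colours-used {c = c} pu pv d with other-cases c d
... | inj₁ refl = _ , pu
... | inj₂ refl = _ , pv

win-C₃ : ∀ pl {p : Position 3 2} → EveryColourUsed p → AliceWins 3 2 pl p
win-C₃ = wins-with-persistent-invariant zero EveryColourUsed EveryColourUsed-persistent
  (λ used _ → EveryColourUsed⇒dominating-C₃ used)

win-A-C₃ : AliceWins 3 2 alice empty
win-A-C₃ = aliceMove zero zero refl (bobMove (one , refl) reply)
  where
  reply : ∀ v c → update empty zero zero v ≡ nothing →
    AliceWins 3 2 alice (update (update empty zero zero) v c)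
  reply zero c ()
  reply one c refl = aliceMove two one refl (win-C₃ bob (both-colours-used {u = zero} {v = two} refl refl))
  reply two c refl = aliceMove one one refl (win-C₃ bob (both-colours-used {u = zero} {v = one} refl refl))

win-B-C₃ : AliceWins 3 2 bob empty
win-B-C₃ = bobMove (zero , refl) reply
  where
  reply : ∀ v c → empty v ≡ nothing → AliceWins 3 2 alice (update empty v c)
  reply v c _ with successor v
  ... | w , v→w = aliceMove w (other c) w-free (win-C₃ bob (both-colours-used {u = v} {v = w} v-colour w-colour))
    where
    p₁ : Position 3 2
    p₁ = update empty v c
    w-free : p₁ w ≡ nothing
    w-free = update-keeps-free empty v c (Succ⇒≢ v→w ∘ sym) refl
    v-colour : update p₁ w (other c) v ≡ just c
    v-colour = update-keeps-colour p₁ {u = v} w (other c) w-free (update-≡ empty v c)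
    w-colour : update p₁ w (other c) w ≡ just (other c)
    w-colour = update-≡ p₁ w (other c)

-- Even cycles

partner : ∀ {q} → Fin (q * 2) → Fin (q * 2)
partner {suc q} zero = one
partner {suc q} one = zero
partner {suc q} (suc (suc v)) = suc (suc (partner {q} v))

partner-involutive : ∀ {q} (v : Fin (q * 2)) → partner {q} (partner {q} v) ≡ v
partner-involutive {suc q} zero = refl
partner-involutive {suc q} one = refl
partner-involutive {suc q} (suc (suc v)) = cong (λ w → suc (suc w)) (partner-involutive {q} v)

partner-≢ : ∀ {q} (v : Fin (q * 2)) → partner {q} v ≢ v
partner-≢ {suc q} zero ()
partner-≢ {suc q} one ()
partner-≢ {suc q} (suc (suc v)) eq = partner-≢ {q} v (Fin.suc-injective (Fin.suc-injective eq))

partner-consecutive : ∀ {q} (v : Fin (q * 2)) →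
  suc (toℕ v) ≡ toℕ (partner {q} v) ⊎ suc (toℕ (partner {q} v)) ≡ toℕ v
partner-consecutive {suc q} zero = inj₁ refl
partner-consecutive {suc q} one = inj₂ refl
partner-consecutive {suc q} (suc (suc v)) = Sum.map (cong (2 +_)) (cong (2 +_)) (partner-consecutive {q} v)

Adj-partner : ∀ {q} (v : Fin (q * 2)) → Adj (q * 2) v (partner {q} v)
Adj-partner {q} v = Sum.map inj₁ inj₁ (partner-consecutive {q} v)

module _ {q : ℕ} where
  open Pairing (partner {q}) (partner-involutive {q}) (λ _ a b → b ≡ other a) (λ _ → other)
               (λ _ _ → refl) (λ _ c → sym (other-involutive c))

  win-B-even : AliceWins (q * 2) 2 bob empty
  win-B-even = alice-wins partners-dominate (λ u → both-free refl (partner-≢ {q} u) refl)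
    where
    partners-dominate : ∀ {p} → Paired p → Full p → AllDominating p
    partners-dominate paired full x c with paired x
    ... | both-free px _ _ = contradiction full (free⇒¬Full px)
    ... | coloured {a} px pσx refl with other-cases a c
    ...   | inj₁ refl = x , inj₁ refl , px
    ...   | inj₂ refl = partner {q} x , inj₂ (Adj-partner {q} x) , pσx

-- Odd cycles

five+-injective : ∀ {m} {i j : Fin m} → _≡_ {A = Fin (5 + m)} (five+ i) (five+ j) → i ≡ j
five+-injective refl = refl

odd-partner : ∀ {h} → Fin (5 + h * 2) → Fin (5 + h * 2)
odd-partner zero = three
odd-partner one = two
odd-partner two = one
odd-partner three = zero
odd-partner four = four
odd-partner {h} (five+ j) = five+ (partner {h} j)

odd-partner-involutive : ∀ {h} (v : Fin (5 + h * 2)) → odd-partner {h} (odd-partner {h} v) ≡ v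
odd-partner-involutive zero = refl
odd-partner-involutive one = refl
odd-partner-involutive two = refl
odd-partner-involutive three = refl
odd-partner-involutive four = refl
odd-partner-involutive {h} (five+ j) = cong five+ (partner-involutive {h} j)

OddRule : ∀ {h} → Fin (5 + h * 2) → Fin 2 → Fin 2 → Set
OddRule zero a b = b ≡ other a
OddRule one a b = b ≡ a
OddRule two a b = b ≡ a
OddRule three a b = b ≡ other a
OddRule _ _ _ = ⊤

odd-reply : ∀ {h} → Fin (5 + h * 2) → Fin 2 → Fin 2
odd-reply zero = other
odd-reply three = other
odd-reply _ = id

OddRule-reply : ∀ {h} (v : Fin (5 + h * 2)) c → OddRule {h} v c (odd-reply {h} v c)
OddRule-reply zero c = refl
OddRule-reply one c = refl
OddRule-reply two c = refl
OddRule-reply three c = refl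
OddRule-reply four c = tt
OddRule-reply (five+ _) c = tt

OddRule-reply-partner : ∀ {h} (v : Fin (5 + h * 2)) c → OddRule {h} (odd-partner {h} v) (odd-reply {h} v c) c
OddRule-reply-partner zero c = sym (other-involutive c)
OddRule-reply-partner one c = refl
OddRule-reply-partner two c = refl
OddRule-reply-partner three c = sym (other-involutive c)
OddRule-reply-partner four c = tt
OddRule-reply-partner (five+ _) c = tt

module _ {h : ℕ} where
  open Pairing (odd-partner {h}) (odd-partner-involutive {h}) (OddRule {h}) (odd-reply {h})
               (OddRule-reply {h}) (OddRule-reply-partner {h})

  Paired-after-four : Paired (update empty four zero)
  Paired-after-four zero = both-free refl (λ ()) refl
  Paired-after-four one = both-free refl (λ ()) refl
  Paired-after-four two = both-free refl (λ ()) refl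
  Paired-after-four three = both-free refl (λ ()) refl
  Paired-after-four four = coloured refl refl tt
  Paired-after-four (five+ j) = both-free refl (partner-≢ {h} j ∘ five+-injective) refl

  Paired⇒¬dominating : ∀ {p} → Paired p → Full p → ¬ AllDominating p
  Paired⇒¬dominating paired full with paired one | paired zero
  ... | both-free p₁ _ _ | _ = contradiction full (free⇒¬Full p₁)
  ... | coloured _ _ _ | both-free p₀ _ _ = contradiction full (free⇒¬Full p₀)
  ... | coloured {a} p₁ p₂ refl | coloured {a'} p₀ p₃ refl with other-cases a a'
  ...   | inj₁ refl = Monochromatic⇒¬dominating
    (one , a , MonochromaticAt-from-neighbours (inj₂ (inj₁ refl)) (inj₁ (inj₁ refl)) (λ ()) p₁ p₀ p₂)
  ...   | inj₂ refl = Monochromatic⇒¬dominating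
    (two , a , MonochromaticAt-from-neighbours (inj₂ (inj₁ refl)) (inj₁ (inj₁ refl)) (λ ()) p₂ p₁
                 (trans p₃ (cong just (other-involutive a))))

  ¬win-B-odd : ¬ AliceWins (5 + h * 2) 2 bob empty
  ¬win-B-odd = ¬win-by-bob-move four zero refl (bob-wins Paired⇒¬dominating Paired-after-four)

¬win-beyond-1 : ∀ {n pl} → ¬ AliceWins n 2 pl empty → (∀ {k} → 2 < k → ¬ AliceWins n k pl empty) →
  ∀ k → 1 < k → ¬ AliceWins n k pl empty
¬win-beyond-1 ¬win-2 ¬win-3+ k 1<k with m≤n⇒m<n∨m≡n 1<k
... | inj₁ 2<k = ¬win-3+ 2<k
... | inj₂ refl = ¬win-2

even-or-odd : ∀ n → (∃ λ q → n ≡ q * 2) ⊎ (∃ λ h → n ≡ 1 + h * 2)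
even-or-odd zero = inj₁ (0 , refl)
even-or-odd (suc n) with even-or-odd n
... | inj₁ (q , n≡2q) = inj₂ (q , cong suc n≡2q)
... | inj₂ (h , n≡1+2h) = inj₁ (suc h , cong suc n≡1+2h)

game-domatic-C₃ : ∀ {n} → n ≡ 3 → GameDomaticIs n 2
game-domatic-C₃ refl = win-A-C₃ , λ _ → ¬win-A-3colours ≤-refl

game-domatic-C≥4 : ∀ {n} → 4 ≤ n → GameDomaticIs n 1
game-domatic-C≥4 4≤n =
  win-1colour alice , ¬win-beyond-1 (¬win-A-2colours 4≤n) (¬win-A-3colours (<⇒≤ 4≤n))

delayed-game-domatic-odd : ∀ {n} → 5 ≤ n → ¬ Even n → DelayedGameDomaticIs n 1
delayed-game-domatic-odd {n} 5≤n odd with even-or-odd n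
... | inj₁ (q , refl) = contradiction (divides q refl) odd
... | inj₂ (suc (suc h) , refl) =
  win-1colour bob , ¬win-beyond-1 (¬win-B-odd {h}) (¬win-B-3colours (s≤s (s≤s (s≤s z≤n))))
delayed-game-domatic-odd (s≤s ()) _ | inj₂ (zero , refl)
delayed-game-domatic-odd (s≤s (s≤s (s≤s ()))) _ | inj₂ (suc zero , refl)

delayed-game-domatic-C₃-or-even : ∀ {n} → 3 ≤ n → n ≡ 3 ⊎ Even n → DelayedGameDomaticIs n 2
delayed-game-domatic-C₃-or-even _ (inj₁ refl) = win-B-C₃ , λ _ → ¬win-B-3colours ≤-refl
delayed-game-domatic-C₃-or-even 3≤n (inj₂ (divides q refl)) = win-B-even {q} , λ _ → ¬win-B-3colours 3≤n

proposition5p4 : (n : ℕ) → 3 ≤ n →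
    ((n ≡ 3 → GameDomaticIs n 2) × (4 ≤ n → GameDomaticIs n 1))
    × ((5 ≤ n → ¬ Even n → DelayedGameDomaticIs n 1)
       × ((n ≡ 3 ⊎ Even n) → DelayedGameDomaticIs n 2))
proposition5p4 n 3≤n =
  (game-domatic-C₃ , game-domatic-C≥4) , (delayed-game-domatic-odd , delayed-game-domatic-C₃-or-even 3≤n)
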